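{- Let $\mathcal X=(\Omega,S)$ be a coset coherent configuration satisfying the distributivity condition, and let $\varphi$ be an algebraic isomorphism from $\mathcal X$ to a coherent configuration $\mathcal X'=(\Omega',S')$. Then (1) $\mathcal X'$ is a coset coherent configuration satisfying the distributivity condition; (2) each $\varphi$-faithful map is $\varphi$-extendable.
   Context: A coherent configuration is a pair $(\Omega,S)$ where $\Omega$ is a finite set and $S$ is a partition of $\Omega\times\Omega$ (basis relations) such that $1_\Omega$ is a union of basis relations, $s^*=\{(\beta,\alpha):(\alpha,\beta)\in s\}\in S$ for all $s\in S$, and for all $r,s,t\in S$ the number $c^t_{rs}=|\alpha r\cap\beta s^*|$ is independent of $(\alpha,\beta)\in t$, where $\alpha r=\{\beta:(\alpha,\beta)\in r\}$. A fiber is a set $\Delta$ with $1_\Delta\in S$. The complex product $rs$ of $r,s\in S$ is the set of basis relations contained in $\{(\alpha,\beta):(\alpha,\gamma)\in r,(\gamma,\beta)\in s\text{ for some }\gamma\}$; for $X,Y\subseteq S$, $XY=\bigcup_{r\in X,s\in Y}rs$. A nonempty $X\subseteq S$ is closed if $XX^*\subseteq X$. The configuration is a coset coherent configuration if $ss^*s=\{s\}$ for all $s\in S$. For a fiber $\Delta$, $\mathcal L(\Delta)$ is the set of all intersections of sets $ss^*$ with $s\in S$, $s\subseteq\Delta\times\Gamma$ for some fiber $\Gamma$. The distributivity condition: $W\cap UV=(W\cap U)(W\cap V)$ for all $U,V,W\in\mathcal L(\Delta)$ and all fibers $\Delta$. For $\alpha,\beta$, $r(\alpha,\beta)$ is the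 basis relation containing $(\alpha,\beta)$. An algebraic isomorphism is a bijection $\varphi:S\to S'$ with $c^t_{rs}=c^{\varphi(t)}_{\varphi(r)\varphi(s)}$ for all $r,s,t$. A bijection $f$ from a subset of $\Omega$ onto a subset of $\Omega'$ is $\varphi$-faithful if $\varphi(r(\alpha,\beta))=r'(\alpha^f,\beta^f)$ for all $\alpha,\beta\in\mathrm{dom}(f)$; it is $\varphi$-extendable if for every $\gamma\in\Omega$ there is a $\varphi$-faithful map with domain $\mathrm{dom}(f)\cup\{\gamma\}$ extending $f$. -}

module Defs where

open import Data.Nat using (ℕ; zero; suc)
open import Data.Bool using (Bool; true; false; _∧_)
open import Data.Fin using (Fin; zero; suc; _≟_)
open import Data.Maybe using (Maybe; just; nothing)
open import Data.Product using (Σ; ∃; _×_; _,_; proj₁; proj₂)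
open import Data.Sum using (_⊎_)
open import Relation.Nullary using (¬_)
open import Relation.Nullary.Decidable using (⌊_⌋)
open import Relation.Binary.PropositionalEquality using (_≡_)
open import Function.Definitions using (Bijective)

count : ∀ {n} → (Fin n → Bool) → ℕ
count {zero} P = 0
count {suc n} P with P zero
... | true  = suc (count {n} (λ i → P (suc i)))
... | false = count {n} (λ i → P (suc i))

-- A coherent configuration on Ω = Fin n whose basis relations are indexed
-- by Fin m: col α β is the (index of the) basis relation r(α,β) containing
-- (α,β).  The partition S of Ω×Ω consists of the fibres of col; the classes
-- are nonempty (surj).
record CC : Set where
  field
    n m  : ℕ
    col  : Fin n → Fin n → Fin m
    surj : (t : Fin m) → Σ (Fin n × Fin n) λ p → col (proj₁ p) (proj₂ p) ≡ t
    -- 1_Ω is a union of basis relations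
    diag : ∀ α β γ → col α α ≡ col β γ → β ≡ γ
    star : Fin m → Fin m
    star-spec₁ : ∀ s α β → col α β ≡ s → col β α ≡ star s
    star-spec₂ : ∀ s α β → col β α ≡ star s → col α β ≡ s

  -- |α r ∩ β s*| = #{γ : (α,γ) ∈ r, (γ,β) ∈ s}
  cnt : Fin n → Fin n → Fin m → Fin m → ℕ
  cnt α β r s = count (λ γ → ⌊ col α γ ≟ r ⌋ ∧ ⌊ col γ β ≟ s ⌋)

  field
    regular : ∀ α β α' β' → col α β ≡ col α' β' → ∀ r s → cnt α β r s ≡ cnt α' β' r s

  -- intersection number c^t_{rs}, computed at a representative pair of t
  c : Fin m → Fin m → Fin m → ℕ
  c t r s = cnt (proj₁ (proj₁ (surj t))) (proj₂ (proj₁ (surj t))) r s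

  SSet : Set₁
  SSet = Fin m → Set

  _≐_ : SSet → SSet → Set
  X ≐ Y = ∀ t → (X t → Y t) × (Y t → X t)

  _∩_ : SSet → SSet → SSet
  (X ∩ Y) t = X t × Y t

  ⟦_⟧ : Fin m → SSet
  ⟦ s ⟧ t = t ≡ s

  prod : Fin m → Fin m → Fin m → Set
  prod r s t = ∀ α β → col α β ≡ t → ∃ λ γ → col α γ ≡ r × col γ β ≡ s

  _·_ : SSet → SSet → SSet
  (X · Y) t = ∃ λ r → ∃ λ s → X r × Y s × prod r s t

  -- d indexes a basis relation 1_Δ (Δ = {α : col α α ≡ d}) that is a fiber
  IsFiber : Fin m → Set
  IsFiber d = ∀ α β → col α β ≡ d → α ≡ β

  -- s ⊆ Δ × Γ for the fibers Δ, Γ given by d, e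
  Between : Fin m → Fin m → Fin m → Set
  Between s d e = ∀ α β → col α β ≡ s → col α α ≡ d × col β β ≡ e

  ss* : Fin m → SSet
  ss* s = ⟦ s ⟧ · ⟦ star s ⟧

  -- U ∈ 𝓛(Δ): U is the intersection of a nonempty family of sets s s*,
  -- with each s ⊆ Δ × Γ for some fiber Γ
  InL : Fin m → SSet → Set₁
  InL d U = Σ (Fin m → Set) λ F →
              (∃ λ s → F s)
            × (∀ s → F s → ∃ λ e → IsFiber e × Between s d e)
            × (U ≐ (λ t → ∀ s → F s → ss* s t))

  Coset : Set
  Coset = ∀ s → ((⟦ s ⟧ · ⟦ star s ⟧) · ⟦ s ⟧) ≐ ⟦ s ⟧

  Distributive : Set₁
  Distributive = ∀ d → IsFiber d → ∀ U V W → InL d U → InL d V → InL d W →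
                 (W ∩ (U · V)) ≐ ((W ∩ U) · (W ∩ V))

open CC public

AlgIso : (X X' : CC) → (Fin (m X) → Fin (m X')) → Set
AlgIso X X' φ = Bijective _≡_ _≡_ φ
              × (∀ t r s → c X t r s ≡ c X' (φ t) (φ r) (φ s))

PMap : CC → CC → Set
PMap X X' = Fin (n X) → Maybe (Fin (n X'))

Faithful : (X X' : CC) → (Fin (m X) → Fin (m X')) → PMap X X' → Set
Faithful X X' φ f =
    (∀ α β a → f α ≡ just a → f β ≡ just a → α ≡ β)
  × (∀ α β a b → f α ≡ just a → f β ≡ just b → φ (col X α β) ≡ col X' a b)

Extendable : (X X' : CC) → (Fin (m X) → Fin (m X')) → PMap X X' → Set
Extendable X X' φ f = ∀ γ → Σ (PMap X X') λ g →
    Faithful X X' φ g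
  × (∀ α a → f α ≡ just a → g α ≡ just a)
  × (∃ λ b → g γ ≡ just b)
  × (∀ α b → g α ≡ just b → (∃ λ a → f α ≡ just a) ⊎ α ≡ γ)

module Submission where

-- Products, fibers, converses and the sets Δ×Γ are all determined
-- by the intersection numbers (t ∈ rs iff c^t_{rs} > 0), so φ preserves them.
-- Consequently the preimage under φ of a complex product is the complex
-- product of the preimages, and the preimage of a member of 𝓛(Δ') lies in
-- 𝓛(Δ).  The coset and distributivity conditions, being statements about
-- complex products of such sets, therefore pass from X to X'.
--
-- To extend a faithful f to a new point γ we need b ∈ Ω' with
-- r'(f(i), b) = φ(r(i,γ)) for every i ∈ dom f, i.e. b in every set a σ.  In a
-- coset distributive configuration these sets satisfy a Helly property: if
-- they pairwise meet, they have a common point (module Helly; distributivity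
-- does the work in `meet-three`).  Pairwise meeting in X' is the image of the
-- obvious meeting in X, so the common point exists and f ∪ {γ ↦ b} is faithful.

open import Defs
open import Data.Bool using (Bool; T; true; false; _∧_)
open import Data.Bool.Properties using (T-∧)
open import Data.Empty using (⊥-elim)
open import Data.Fin using (Fin; zero; suc) renaming (_≟_ to _≟ᶠ_)
open import Data.List using (List; []; _∷_; mapMaybe; allFin)
open import Data.List.Membership.Propositional using (_∈_)
open import Data.List.Membership.Propositional.Properties using (∈-allFin)
open import Data.List.Relation.Unary.All as All using (All; []; _∷_)
open import Data.List.Relation.Unary.Any using (here; there)
open import Data.Maybe using (Maybe; just; nothing)
import Data.Maybe as Maybe
open import Data.Maybe.Properties using (just-injective)
open import Data.Nat using (suc; _<_; s≤s; z≤n)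
open import Data.Product using (Σ; ∃; _×_; _,_; proj₁; proj₂; swap; map₂)
open import Data.Sum using (_⊎_; inj₁; inj₂)
open import Function using (id; case_of_; Equivalence)
open import Relation.Binary.PropositionalEquality
open import Relation.Nullary using (yes; no)
open import Relation.Nullary.Decidable using (⌊_⌋; toWitness; fromWitness)

_⟺_ : ∀ {a b} → Set a → Set b → Set _
A ⟺ B = (A → B) × (B → A)

⟺-trans : ∀ {a b c} {A : Set a} {B : Set b} {C : Set c} → A ⟺ B → B ⟺ C → A ⟺ C
⟺-trans (f , f⁻) (g , g⁻) = (λ x → g (f x)) , (λ z → f⁻ (g⁻ z))

⟺-sym : ∀ {a b} {A : Set a} {B : Set b} → A ⟺ B → B ⟺ A
⟺-sym = swap

count-pos⇒witness : ∀ {n} (P : Fin n → Bool) → 0 < count P → ∃ λ i → T (P i)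
count-pos⇒witness {suc n} P h with P zero in eq
... | true = zero , subst T (sym eq) _
... | false with count-pos⇒witness (λ i → P (suc i)) h
...   | i , t = suc i , t

witness⇒count-pos : ∀ {n} (P : Fin n → Bool) (i : Fin n) → T (P i) → 0 < count P
witness⇒count-pos {suc n} P zero t with P zero
... | true = s≤s z≤n
... | false = ⊥-elim t
witness⇒count-pos {suc n} P (suc i) t with P zero
... | true = s≤s z≤n
... | false = witness⇒count-pos (λ j → P (suc j)) i t

∈-mapMaybe⁺ : ∀ {A B : Set} (h : A → Maybe B) {x y xs} → x ∈ xs → h x ≡ just y → y ∈ mapMaybe h xs
∈-mapMaybe⁺ h {xs = x ∷ _} (here refl) hx with h x
... | just _ = here (sym (just-injective hx))
∈-mapMaybe⁺ h {xs = x ∷ _} (there p) hx with h x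
... | just _ = there (∈-mapMaybe⁺ h p hx)
... | nothing = ∈-mapMaybe⁺ h p hx

∈-mapMaybe⁻ : ∀ {A B : Set} (h : A → Maybe B) {y} xs → y ∈ mapMaybe h xs → ∃ λ x → h x ≡ just y
∈-mapMaybe⁻ h (x ∷ xs) p with h x in eq
... | nothing = ∈-mapMaybe⁻ h xs p
... | just _ with p
...   | here refl = x , eq
...   | there q = ∈-mapMaybe⁻ h xs q

module Facts (Y : CC) where

  path? : Fin (n Y) → Fin (n Y) → Fin (m Y) → Fin (m Y) → Fin (n Y) → Bool
  path? α β r s γ = ⌊ col Y α γ ≟ᶠ r ⌋ ∧ ⌊ col Y γ β ≟ᶠ s ⌋

  path?-sound : ∀ {α β γ r s} → T (path? α β r s γ) → col Y α γ ≡ r × col Y γ β ≡ s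
  path?-sound {α} {β} {γ} {r} {s} t with Equivalence.to (T-∧ {⌊ col Y α γ ≟ᶠ r ⌋} {⌊ col Y γ β ≟ᶠ s ⌋}) t
  ... | t₁ , t₂ = toWitness t₁ , toWitness t₂

  path?-complete : ∀ {α β γ r s} → col Y α γ ≡ r → col Y γ β ≡ s → T (path? α β r s γ)
  path?-complete {α} {β} {γ} {r} {s} e₁ e₂ =
    Equivalence.from (T-∧ {⌊ col Y α γ ≟ᶠ r ⌋} {⌊ col Y γ β ≟ᶠ s ⌋}) (fromWitness e₁ , fromWitness e₂)

  path⇒cnt-pos : ∀ {α β γ r s} → col Y α γ ≡ r → col Y γ β ≡ s → 0 < cnt Y α β r s
  path⇒cnt-pos {α} {β} {γ} {r} {s} e₁ e₂ = witness⇒count-pos (path? α β r s) γ (path?-complete e₁ e₂)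

  cnt-pos⇒path : ∀ {α β r s} → 0 < cnt Y α β r s → ∃ λ γ → col Y α γ ≡ r × col Y γ β ≡ s
  cnt-pos⇒path {α} {β} {r} {s} h = map₂ path?-sound (count-pos⇒witness (path? α β r s) h)

  -- t ∈ rs iff c^t_{rs} > 0 (by regularity one pair of t decides it)
  prod⇒c-pos : ∀ {r s t} → prod Y r s t → 0 < c Y t r s
  prod⇒c-pos {t = t} p with surj Y t
  ... | (α , β) , e with p α β e
  ...   | γ , e₁ , e₂ = path⇒cnt-pos e₁ e₂

  c-pos⇒prod : ∀ {r s t} → 0 < c Y t r s → prod Y r s t
  c-pos⇒prod {r} {s} {t} h α β e with surj Y t
  ... | (α₀ , β₀) , e₀ = cnt-pos⇒path (subst (0 <_) (regular Y α₀ β₀ α β (trans e₀ (sym e)) r s) h)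

  prod-intro : ∀ {α β γ r s t} → col Y α β ≡ t → col Y α γ ≡ r → col Y γ β ≡ s → prod Y r s t
  prod-intro {α} {β} refl e₁ e₂ = c-pos⇒prod {t = col Y α β}
    (subst (0 <_) (regular Y α β _ _ (sym (proj₂ (surj Y (col Y α β)))) _ _) (path⇒cnt-pos e₁ e₂))

  star-col : ∀ α β → col Y β α ≡ star Y (col Y α β)
  star-col α β = star-spec₁ Y _ α β refl

  star-involutive : ∀ s → star Y (star Y s) ≡ s
  star-involutive s with surj Y s
  ... | (α , β) , refl = sym (trans (star-col β α) (cong (star Y) (star-col α β)))

  ss*⇒prod : ∀ {s t} → ss* Y s t → prod Y s (star Y s) t
  ss*⇒prod (_ , _ , refl , refl , p) = p

  prod⇒ss* : ∀ {s t} → prod Y s (star Y s) t → ss* Y s t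
  prod⇒ss* p = _ , _ , refl , refl , p

  ·-cong : ∀ {A A' B B'} → _≐_ Y A A' → _≐_ Y B B' → _≐_ Y (_·_ Y A B) (_·_ Y A' B')
  ·-cong A≐ B≐ t = (λ { (r , s , a , b , p) → r , s , proj₁ (A≐ r) a , proj₁ (B≐ s) b , p })
                 , (λ { (r , s , a , b , p) → r , s , proj₂ (A≐ r) a , proj₂ (B≐ s) b , p })

  fiber-col : ∀ α → IsFiber Y (col Y α α)
  fiber-col α β γ e = diag Y α β γ (sym e)

  fiber-point : ∀ {d} → IsFiber Y d → ∃ λ α → col Y α α ≡ d
  fiber-point {d} fd with surj Y d
  ... | (α , β) , e with fd α β e
  ...   | refl = α , e

  LeftUnit : Fin (m Y) → Set
  LeftUnit d = ∀ r t → prod Y d r t → r ≡ t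

  fiber⇒left-unit : ∀ {d} → IsFiber Y d → LeftUnit d
  fiber⇒left-unit fd r t p with surj Y t
  ... | (α , β) , e with p α β e
  ...   | γ , e₁ , e₂ with fd α γ e₁
  ...     | refl = trans (sym e₂) e

  left-unit⇒fiber : ∀ {d} → LeftUnit d → IsFiber Y d
  left-unit⇒fiber {d} ld α β e =
    diag Y β α β (trans (ld (col Y β β) d (prod-intro e e refl)) (sym e))

  unit-product⇒star : ∀ {r s d} → IsFiber Y d → prod Y r s d → s ≡ star Y r
  unit-product⇒star fd p with fiber-point fd
  ... | α , e with p α α e
  ...   | γ , e₁ , e₂ = trans (sym e₂) (star-spec₁ Y _ α γ e₁)

  left-fiber : ∀ {α β α' β'} → col Y α' β' ≡ col Y α β → col Y α' α' ≡ col Y α α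
  left-fiber {α} {β} {α'} {β'} e with prod-intro {α} {β} {α} refl refl refl α' β' e
  ... | γ , e₁ , _ with diag Y α α' γ (sym e₁)
  ...   | refl = e₁

  between-col : ∀ α β → Between Y (col Y α β) (col Y α α) (col Y β β)
  between-col α β α' β' e =
    left-fiber e , left-fiber (trans (star-col α' β') (trans (cong (star Y) e) (sym (star-col α β))))

  between-star : ∀ {s d e} → Between Y s d e → Between Y (star Y s) e d
  between-star b α β x = swap (b β α (star-spec₂ Y _ β α x))

  between⇒prods : ∀ {s d e} → Between Y s d e → prod Y d s s × prod Y s e s
  between⇒prods b = (λ α β x → α , proj₁ (b α β x) , x) , (λ α β x → β , x , proj₂ (b α β x))

  prods⇒between : ∀ {s d e} → IsFiber Y d → IsFiber Y e → prod Y d s s × prod Y s e s → Between Y s d e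
  prods⇒between fd fe (p , q) α β x with p α β x | q α β x
  ... | γ , e₁ , _ | δ , _ , e₂ with fd α γ e₁ | fe δ β e₂
  ...   | refl | refl = e₁ , e₂

-- Everything expressible through intersection numbers is preserved by an
-- algebraic isomorphism φ : X → X'.
module Transfer (X X' : CC) (φ : Fin (m X) → Fin (m X')) (iso : AlgIso X X' φ) where
  private
    module F = Facts X
    module F' = Facts X'

  φ-injective : ∀ {r s} → φ r ≡ φ s → r ≡ s
  φ-injective = proj₁ (proj₁ iso)

  data Image : Fin (m X') → Set where
    image : ∀ s → Image (φ s)

  image? : ∀ s' → Image s'
  image? s' with proj₂ (proj₁ iso) s'
  ... | s , φs≡ = subst Image (φs≡ refl) (image s)

  prod-φ : ∀ {r s t} → prod X r s t ⟺ prod X' (φ r) (φ s) (φ t)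
  prod-φ {r} {s} {t} =
      (λ p → F'.c-pos⇒prod (subst (0 <_) (proj₂ iso t r s) (F.prod⇒c-pos p)))
    , (λ p → F.c-pos⇒prod (subst (0 <_) (sym (proj₂ iso t r s)) (F'.prod⇒c-pos p)))

  fiber-φ : ∀ {d} → IsFiber X d ⟺ IsFiber X' (φ d)
  fiber-φ {d} = (λ fd → F'.left-unit⇒fiber (left-unit fd)) , (λ fd → F.left-unit⇒fiber (left-unit⁻ fd))
    where
    left-unit : IsFiber X d → F'.LeftUnit (φ d)
    left-unit fd r' t' p with image? r' | image? t'
    ... | image r | image t = cong φ (F.fiber⇒left-unit fd r t (proj₂ prod-φ p))

    left-unit⁻ : IsFiber X' (φ d) → F.LeftUnit d
    left-unit⁻ fd r t p = φ-injective (F'.fiber⇒left-unit fd (φ r) (φ t) (proj₁ prod-φ p))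

  -- s s* contains the fiber at a start point of s; by unit-product⇒star this
  -- determines the converse, in X and in X' alike
  star-φ : ∀ s → φ (star X s) ≡ star X' (φ s)
  star-φ s with surj X s
  ... | (α , β) , refl = F'.unit-product⇒star (proj₁ fiber-φ (F.fiber-col α))
                           (proj₁ prod-φ (F.prod-intro {α} {α} {β} refl refl (F.star-col α β)))

  between-φ : ∀ {s d e} → IsFiber X d → IsFiber X e → Between X s d e ⟺ Between X' (φ s) (φ d) (φ e)
  between-φ fd fe =
      (λ b → let (p , q) = F.between⇒prods b in
             F'.prods⇒between (proj₁ fiber-φ fd) (proj₁ fiber-φ fe) (proj₁ prod-φ p , proj₁ prod-φ q))
    , (λ b → let (p , q) = F'.between⇒prods b in
             F.prods⇒between fd fe (proj₂ prod-φ p , proj₂ prod-φ q))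

  pull : SSet X' → SSet X
  pull A t = A (φ t)

  pull-· : ∀ A B → _≐_ X (pull (_·_ X' A B)) (_·_ X (pull A) (pull B))
  pull-· A B t = to , (λ { (r , s , a , b , p) → φ r , φ s , a , b , proj₁ prod-φ p })
    where
    to : pull (_·_ X' A B) t → _·_ X (pull A) (pull B) t
    to (r' , s' , a , b , p) with image? r' | image? s'
    ... | image r | image s = r , s , a , b , proj₂ prod-φ p

  pull-⟦⟧ : ∀ s → _≐_ X (pull (⟦_⟧ X' (φ s))) (⟦_⟧ X s)
  pull-⟦⟧ s t = φ-injective , cong φ

  pull-ss* : ∀ s → _≐_ X (pull (ss* X' (φ s))) (ss* X s)
  pull-ss* s t =
      (λ x → F.prod⇒ss* (proj₂ prod-φ (subst (λ u → prod X' (φ s) u (φ t)) (sym (star-φ s)) (F'.ss*⇒prod x))))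
    , (λ x → F'.prod⇒ss* (subst (λ u → prod X' (φ s) u (φ t)) (star-φ s) (proj₁ prod-φ (F.ss*⇒prod x))))

  -- σσ*σ = {σ} in X' is the pullback of the same identity in X
  coset-φ : Coset X → Coset X'
  coset-φ cX s' t' with image? s' | image? t'
  ... | image s | image t =
    ⟺-trans (pull-· (ss* X' (φ s)) (⟦_⟧ X' (φ s)) t)
      (⟺-trans (F.·-cong (pull-ss* s) (pull-⟦⟧ s) t)
        (⟺-trans (cX s t) (cong φ , φ-injective)))

  InL-pull : ∀ {d U} → IsFiber X d → InL X' (φ d) U → InL X d (pull U)
  InL-pull {d} {U} fd (Fam' , (s₀' , h₀) , ends' , U≐) =
    (λ s → Fam' (φ s)) , nonempty (image? s₀') h₀ , ends , λ t → to t , from t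
    where
    nonempty : ∀ {s'} → Image s' → Fam' s' → ∃ λ s → Fam' (φ s)
    nonempty (image s) h = s , h

    ends : ∀ s → Fam' (φ s) → ∃ λ e → IsFiber X e × Between X s d e
    ends s h with ends' (φ s) h
    ... | e' , fe' , b' with image? e'
    ...   | image e = e , proj₂ fiber-φ fe' , proj₂ (between-φ fd (proj₂ fiber-φ fe')) b'

    to : ∀ t → pull U t → ∀ s → Fam' (φ s) → ss* X s t
    to t u s h = proj₁ (pull-ss* s t) (proj₁ (U≐ (φ t)) u (φ s) h)

    from : ∀ t → (∀ s → Fam' (φ s) → ss* X s t) → pull U t
    from t k = proj₂ (U≐ (φ t)) all
      where
      all : ∀ s' → Fam' s' → ss* X' s' (φ t)
      all s' h with image? s'
      ... | image s = proj₂ (pull-ss* s t) (k s h)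

  -- the distributivity identity for U, V, W ∈ 𝓛(Δ') is the pullback of the
  -- identity for their preimages, which lie in 𝓛(Δ)
  distributive-φ : Distributive X → Distributive X'
  distributive-φ dX d' fd' U V W iU iV iW t' with image? d' | image? t'
  ... | image d | image t =
    ⟺-trans (map₂ (proj₁ (pull-· U V t)) , map₂ (proj₂ (pull-· U V t)))
      (⟺-trans (dX d fd (pull U) (pull V) (pull W) (InL-pull fd iU) (InL-pull fd iV) (InL-pull fd iW) t)
        (⟺-sym (pull-· (_∩_ X' W U) (_∩_ X' W V) t)))
    where
    fd : IsFiber X d
    fd = proj₂ fiber-φ fd'

-- Helly property of the sets aσ = {y : r(a,y) = σ} inside a fixed fiber Γ
-- (given by e) of a coset coherent configuration with distributivity.
module Helly (Y : CC) (coset : Coset Y) (distributive : Distributive Y)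
             (e : Fin (m Y)) (fiber-e : IsFiber Y e) where
  private
    module F = Facts Y

  -- a constraint (a , σ) stands for the set aσ
  Constraint : Set
  Constraint = Fin (n Y) × Fin (m Y)

  Sat : Constraint → Fin (n Y) → Set
  Sat c y = col Y (proj₁ c) y ≡ proj₂ c

  SatAll : List Constraint → Fin (n Y) → Set
  SatAll cs y = All (λ c → Sat c y) cs

  -- σ ⊆ Δ(a) × Γ, so aσ ⊆ Γ
  Valid : Constraint → Set
  Valid c = Between Y (proj₂ c) (col Y (proj₁ c) (proj₁ c)) e

  Meet : Constraint → Constraint → Set
  Meet c c' = ∃ λ y → Sat c y × Sat c' y

  valid-fiber : ∀ {c y} → Valid c → Sat c y → col Y y y ≡ e
  valid-fiber {c} {y} v s = proj₂ (v (proj₁ c) y s)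

  sat-ss* : ∀ {a σ y y'} → col Y a y ≡ σ → col Y a y' ≡ σ → ss* Y (star Y σ) (col Y y y')
  sat-ss* {a} {σ} {y} {y'} e₁ e₂ =
    F.prod⇒ss* (F.prod-intro {y} {y'} {a} refl (star-spec₁ Y σ a y e₁) (trans e₂ (sym (F.star-involutive σ))))

  -- conversely, by the coset condition σσ*σ = σ, aσ is closed under σ*σ
  ss*-sat : ∀ {a σ y y'} → col Y a y ≡ σ → ss* Y (star Y σ) (col Y y y') → col Y a y' ≡ σ
  ss*-sat {a} {σ} {y} {y'} ay x with F.ss*⇒prod x y y' refl
  ... | z , yz , zy' = proj₁ (coset σ (col Y a y')) (col Y a z , σ , az∈σσ* , refl , ay'∈az·σ)
    where
    az∈σσ* : ss* Y σ (col Y a z)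
    az∈σσ* = F.prod⇒ss* (F.prod-intro {a} {z} {y} refl ay yz)

    ay'∈az·σ : prod Y (col Y a z) σ (col Y a y')
    ay'∈az·σ = F.prod-intro {a} {y'} {z} refl refl (trans zy' (F.star-involutive σ))

  ss*-swap : ∀ {u y y'} → ss* Y u (col Y y y') → ss* Y u (col Y y' y)
  ss*-swap {u} {y} {y'} x with F.ss*⇒prod x y y' refl
  ... | z , yz , zy' = F.prod⇒ss* (F.prod-intro {y'} {y} {z} refl
                          (trans (star-spec₁ Y _ z y' zy') (F.star-involutive u)) (star-spec₁ Y u y z yz))

  -- Diff cs = ∩_{(a,σ) ∈ cs} σ*σ: the relations between two points of ∩ cs
  Gens : List Constraint → Fin (m Y) → Set
  Gens cs s = ∃ λ c → c ∈ cs × s ≡ star Y (proj₂ c)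

  Diff : List Constraint → SSet Y
  Diff cs t = ∀ s → Gens cs s → ss* Y s t

  diff-intro : ∀ {cs y y'} → SatAll cs y → SatAll cs y' → Diff cs (col Y y y')
  diff-intro sy sy' s (c , c∈ , refl) = sat-ss* (All.lookup sy c∈) (All.lookup sy' c∈)

  diff-elim : ∀ {cs y y'} → SatAll cs y → Diff cs (col Y y y') → SatAll cs y'
  diff-elim [] _ = []
  diff-elim {c ∷ _} (sy ∷ sys) d =
    ss*-sat sy (d _ (c , here refl , refl)) ∷ diff-elim sys (λ s (c' , c'∈ , eq) → d s (c' , there c'∈ , eq))

  diff-swap : ∀ {cs y y'} → Diff cs (col Y y y') → Diff cs (col Y y' y)
  diff-swap d s g = ss*-swap (d s g)

  diff-InL : ∀ {c cs} → All Valid (c ∷ cs) → InL Y e (Diff (c ∷ cs))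
  diff-InL {c} {cs} vs = Gens (c ∷ cs) , (star Y (proj₂ c) , c , here refl , refl) , ends , λ t → id , id
    where
    ends : ∀ s → Gens (c ∷ cs) s → ∃ λ e' → IsFiber Y e' × Between Y s e e'
    ends s (c' , c'∈ , refl) = col Y (proj₁ c') (proj₁ c') , F.fiber-col _ , F.between-star (All.lookup vs c'∈)

  -- the use of distributivity: if x ∈ ∩cs ∩ j, u ∈ ∩cs ∩ k and v ∈ j ∩ k,
  -- then ∩cs ∩ j ∩ k ≠ ∅.  With U = Diff cs, V = Diff [k], W = Diff [j]
  -- we have r(x,v) ∈ W ∩ UV = (W ∩ U)(W ∩ V), whose middle point works.
  meet-three : ∀ {cs j k x u v} → All Valid cs → Valid j → Valid k →
               SatAll cs x → Sat j x → SatAll cs u → Sat k u → Sat j v → Sat k v →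
               ∃ λ w → SatAll cs w × Sat j w × Sat k w
  meet-three {[]} {v = v} _ _ _ _ _ _ _ jv kv = v , [] , jv , kv
  meet-three {cs@(_ ∷ _)} {j} {k} {x} {u} {v} vcs vj vk xcs jx ucs ku jv kv
    with proj₁ (distributive e fiber-e (Diff cs) (Diff (k ∷ [])) (Diff (j ∷ []))
                  (diff-InL vcs) (diff-InL (vk ∷ [])) (diff-InL (vj ∷ [])) (col Y x v))
               (diff-intro (jx ∷ []) (jv ∷ []) ,
                (col Y x u , col Y u v , diff-intro xcs ucs , diff-intro (ku ∷ []) (kv ∷ []) ,
                 F.prod-intro {x} {v} {u} refl refl refl))
  ... | r , s , (r∈W , r∈U) , (_ , s∈V) , p with p x v refl
  ...   | w , refl , refl with diff-elim (jx ∷ []) r∈W | diff-elim (kv ∷ []) (diff-swap s∈V)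
  ...     | jw ∷ [] | kw ∷ [] = w , diff-elim xcs r∈U , jw , kw

  add-constraint : ∀ {k} cs {x} → All Valid cs → Valid k → (∃ λ y → Sat k y) →
                   All (λ c → Meet c k) cs → SatAll cs x → ∃ λ w → SatAll cs w × Sat k w
  add-constraint [] _ _ (y , ky) _ _ = y , [] , ky
  add-constraint (c ∷ cs) (vc ∷ vcs) vk nk ((v , cv , kv) ∷ ms) (cx ∷ csx)
    with add-constraint cs vcs vk nk ms csx
  ... | u , csu , ku with meet-three vcs vc vk csx cx csu ku cv kv
  ...   | w , csw , cw , kw = w , cw ∷ csw , kw

  helly : ∀ cs → All Valid cs → (∀ {c c'} → c ∈ cs → c' ∈ cs → Meet c c') →
          ∃ λ b → col Y b b ≡ e × SatAll cs b
  helly [] _ _ with F.fiber-point fiber-e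
  ... | b , eb = b , eb , []
  helly (c ∷ cs) (vc ∷ vcs) meet with helly cs vcs (λ p q → meet (there p) (there q))
  ... | x , _ , csx with meet (here refl) (here refl)
  ...   | y , cy , _ with add-constraint cs vcs vc (y , cy) (All.tabulate λ p → meet (there p) (here refl)) csx
  ...     | w , csw , cw = w , valid-fiber vc cw , cw ∷ csw

module Extension (X X' : CC) (φ : Fin (m X) → Fin (m X')) (iso : AlgIso X X' φ)
                 (f : PMap X X') (faithful : Faithful X X' φ f) (γ : Fin (n X)) where
  open Transfer X X' φ iso
  private
    module F = Facts X

  -- the relation the image of γ must have to the image of i
  σ : Fin (n X) → Fin (m X')
  σ i = φ (col X i γ)

  Target : Fin (n X') → Set
  Target b = col X' b b ≡ φ (col X γ γ) × (∀ i a → f i ≡ just a → col X' a b ≡ σ i)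

  image-diag : ∀ {i a} → f i ≡ just a → col X' a a ≡ φ (col X i i)
  image-diag {i} e = sym (proj₂ faithful i i _ _ e e)

  constraint : Fin (n X) → Maybe (Fin (n X') × Fin (m X'))
  constraint i = Maybe.map (λ a → a , σ i) (f i)

  constraints : List (Fin (n X') × Fin (m X'))
  constraints = mapMaybe constraint (allFin (n X))

  constraint-sound : ∀ {c} → c ∈ constraints → ∃ λ i → f i ≡ just (proj₁ c) × proj₂ c ≡ σ i
  constraint-sound {c} c∈ with ∈-mapMaybe⁻ constraint (allFin (n X)) c∈
  ... | i , eq with f i in fi
  ...   | just a with just-injective eq
  ...     | refl = i , fi , refl

  constraint-complete : ∀ {i a} → f i ≡ just a → (a , σ i) ∈ constraints
  constraint-complete {i} fi = ∈-mapMaybe⁺ constraint (∈-allFin i) (cong (Maybe.map _) fi)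

  constraint-valid : ∀ {i a} → f i ≡ just a → Between X' (σ i) (col X' a a) (φ (col X γ γ))
  constraint-valid {i} fi = subst (λ d → Between X' (σ i) d (φ (col X γ γ))) (sym (image-diag fi))
    (proj₁ (between-φ (F.fiber-col i) (F.fiber-col γ)) (F.between-col i γ))

  -- ... and any two meet, since r(i,k) ∈ r(i,γ) r(γ,k) in X
  constraints-meet : ∀ {i k a b} → f i ≡ just a → f k ≡ just b → ∃ λ y → col X' a y ≡ σ i × col X' b y ≡ σ k
  constraints-meet {i} {k} {a} {b} fi fk
    with proj₁ prod-φ (F.prod-intro {i} {k} {γ} refl refl refl) a b (sym (proj₂ faithful i k a b fi fk))
  ... | y , ay , yb = y , ay , star-spec₂ X' (σ k) b y
                         (trans yb (trans (cong φ (F.star-col k γ)) (star-φ (col X k γ))))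

  -- by the Helly property of X' the constraints have a common point b
  module CommonPoint (cY : Coset X') (dY : Distributive X') where
    open Helly X' cY dY (φ (col X γ γ)) (proj₁ fiber-φ (F.fiber-col γ))

    valid : ∀ {c} → c ∈ constraints → Valid c
    valid c∈ with constraint-sound c∈
    ... | i , fi , refl = constraint-valid fi

    meet : ∀ {c c'} → c ∈ constraints → c' ∈ constraints → Meet c c'
    meet c∈ c'∈ with constraint-sound c∈ | constraint-sound c'∈
    ... | i , fi , refl | k , fk , refl = constraints-meet fi fk

    target : ∃ Target
    target with helly constraints (All.tabulate valid) meet
    ... | b , bb , sat = b , bb , λ i a fi → All.lookup sat (constraint-complete fi)

  ExtensionAt : Set
  ExtensionAt = Σ (PMap X X') λ g →
      Faithful X X' φ g
    × (∀ α a → f α ≡ just a → g α ≡ just a)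
    × (∃ λ b → g γ ≡ just b)
    × (∀ α b → g α ≡ just b → (∃ λ a → f α ≡ just a) ⊎ α ≡ γ)

  module Update (b : Fin (n X')) (fγ : f γ ≡ nothing) (tb : Target b) where
    g : PMap X X'
    g α with α ≟ᶠ γ
    ... | yes _ = just b
    ... | no _ = f α

    g-new : g γ ≡ just b
    g-new with γ ≟ᶠ γ
    ... | yes _ = refl
    ... | no γ≢γ = ⊥-elim (γ≢γ refl)

    g-old : ∀ {α a} → f α ≡ just a → g α ≡ just a
    g-old {α} fα with α ≟ᶠ γ
    ... | yes refl = case trans (sym fα) fγ of λ ()
    ... | no _ = fα

    g-cases : ∀ {α a} → g α ≡ just a → (α ≡ γ × a ≡ b) ⊎ f α ≡ just a
    g-cases {α} gα with α ≟ᶠ γ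
    ... | yes α≡γ = inj₁ (α≡γ , sym (just-injective gα))
    ... | no _ = inj₂ gα

    -- b is not an old image: r'(f β, b) = φ(r(β,γ)) would give r(β,β) = r(β,γ)
    b-fresh : ∀ {β} → f β ≡ just b → β ≡ γ
    b-fresh {β} fβ = diag X β β γ (φ-injective (trans (sym (image-diag {β} fβ)) (proj₂ tb β b fβ)))

    g-injective : ∀ α β a → g α ≡ just a → g β ≡ just a → α ≡ β
    g-injective α β a gα gβ with g-cases {α} gα | g-cases {β} gβ
    ... | inj₁ (α≡γ , _) | inj₁ (β≡γ , _) = trans α≡γ (sym β≡γ)
    ... | inj₁ (α≡γ , refl) | inj₂ fβ = trans α≡γ (sym (b-fresh {β} fβ))
    ... | inj₂ fα | inj₁ (β≡γ , refl) = trans (b-fresh {α} fα) (sym β≡γ)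
    ... | inj₂ fα | inj₂ fβ = proj₁ faithful α β a fα fβ

    g-col : ∀ α β a a' → g α ≡ just a → g β ≡ just a' → φ (col X α β) ≡ col X' a a'
    g-col α β a a' gα gβ with g-cases {α} gα | g-cases {β} gβ
    ... | inj₁ (refl , refl) | inj₁ (refl , refl) = sym (proj₁ tb)
    ... | inj₁ (refl , refl) | inj₂ fβ =
      trans (cong φ (F.star-col β γ)) (trans (star-φ (col X β γ)) (sym (star-spec₁ X' _ a' b (proj₂ tb β a' fβ))))
    ... | inj₂ fα | inj₁ (refl , refl) = sym (proj₂ tb α a fα)
    ... | inj₂ fα | inj₂ fβ = proj₂ faithful α β a a' fα fβ

    extension : ExtensionAt
    extension = g , (g-injective , g-col) , (λ α a → g-old {α}) , (b , g-new) , domain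
      where
      domain : ∀ α a → g α ≡ just a → (∃ λ a' → f α ≡ just a') ⊎ α ≡ γ
      domain α a gα with g-cases {α} gα
      ... | inj₁ (α≡γ , _) = inj₂ α≡γ
      ... | inj₂ fα = inj₁ (a , fα)

  extension : Coset X' → Distributive X' → ExtensionAt
  extension cY dY with f γ in fγ
  ... | just b = f , faithful , (λ α a fα → fα) , (b , fγ) , (λ α a fα → inj₁ (a , fα))
  ... | nothing with CommonPoint.target cY dY
  ...   | b , tb = Update.extension b fγ tb

lemma6p1 : (X X' : CC) (φ : Fin (m X) → Fin (m X')) →
    Coset X → Distributive X → AlgIso X X' φ →
    (Coset X' × Distributive X') × (∀ f → Faithful X X' φ f → Extendable X X' φ f)
lemma6p1 X X' φ cX dX iso = (cX' , dX') , λ f faithful γ → Extension.extension X X' φ iso f faithful γ cX' dX'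
  where
  open Transfer X X' φ iso
  cX' : Coset X'
  cX' = coset-φ cX
  dX' : Distributive X'
  dX' = distributive-φ dX
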